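{- Let $H$ be a minimal solution to $k$-DST which is a simple graph. Then for every edge $e\in E(H)$ and every integer $\ell\ge 2$, the number of directed paths in $H$ that start at the root $r$, have length at most $\ell$, and whose last edge is $e$ is at most $k^{\ell-2}$; that is, $|Q^H_\ell(e)|\le k^{\ell-2}$.
   Context: An instance of $k$-DST consists of a directed graph $G$ with edge costs, a root vertex $r$, a set of terminals $T\subseteq V(G)$ and an integer $k\ge1$. A feasible solution is a subgraph $H\subseteq G$ that contains $k$ pairwise edge-disjoint directed $r,t$-paths for every $t\in T$. A minimal solution is a feasible solution $H$ such that for every edge $e\in E(H)$, the graph $H\setminus e$ is not feasible. The length of a path is its number of edges. $Q^H_\ell(e)$ denotes the set of directed paths in $H$ starting at $r$, of length at most $\ell$, whose last edge is $e$. -}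

module Defs where

open import Data.Nat using (ℕ; _≤_)
open import Data.Fin using (Fin)
open import Data.List using (List; []; _∷_; _++_; length)
open import Data.List.Relation.Unary.Unique.Propositional using (Unique)
open import Data.List.Relation.Unary.All using (All)
open import Data.List.Membership.Propositional using (_∈_)
open import Data.Product using (Σ; ∃; _×_; _,_)
open import Data.Vec using (Vec; lookup)
open import Relation.Binary.PropositionalEquality using (_≡_; _≢_)
open import Relation.Nullary using (¬_)

-- Representing the edge set as a relation means there are no parallel
-- edges; together with 'Loopless' this is a simple digraph.
Digraph : ℕ → Set₁
Digraph n = Fin n → Fin n → Set

Loopless : ∀ {n} → Digraph n → Set
Loopless H = ∀ v → ¬ H v v

Remove : ∀ {n} → Digraph n → Fin n → Fin n → Digraph n
Remove H u v x y = H x y × ¬ ((x ≡ u) × (y ≡ v))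

edgesOf : ∀ {n} → List (Fin n) → List (Fin n × Fin n)
edgesOf [] = []
edgesOf (x ∷ []) = []
edgesOf (x ∷ y ∷ xs) = (x , y) ∷ edgesOf (y ∷ xs)

pathLength : ∀ {n} → List (Fin n) → ℕ
pathLength vs = length (edgesOf vs)

record IsPath {n} (H : Digraph n) (s t : Fin n) (vs : List (Fin n)) : Set where
  field
    starts   : ∃ λ rest → vs ≡ s ∷ rest
    ends     : ∃ λ init → vs ≡ init ++ (t ∷ [])
    inGraph  : All (λ e → H (Data.Product.proj₁ e) (Data.Product.proj₂ e)) (edgesOf vs)
    distinct : Unique vs

EdgeDisjoint : ∀ {n} → List (Fin n) → List (Fin n) → Set
EdgeDisjoint p q = ∀ e → e ∈ edgesOf p → ¬ (e ∈ edgesOf q)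

HasDisjointPaths : ∀ {n} → Digraph n → ℕ → Fin n → Fin n → Set
HasDisjointPaths {n} H k r t =
  Σ (Vec (List (Fin n)) k) λ ps →
    (∀ i → IsPath H r t (lookup ps i)) ×
    (∀ i j → i ≢ j → EdgeDisjoint (lookup ps i) (lookup ps j))

Feasible : ∀ {n} → Digraph n → Fin n → (Fin n → Set) → ℕ → Set
Feasible H r T k = ∀ t → T t → HasDisjointPaths H k r t

MinimalSolution : ∀ {n} → Digraph n → Fin n → (Fin n → Set) → ℕ → Set
MinimalSolution H r T k =
  Feasible H r T k × (∀ u v → H u v → ¬ Feasible (Remove H u v) r T k)

InQ : ∀ {n} → Digraph n → Fin n → ℕ → Fin n → Fin n → List (Fin n) → Set
InQ H r ℓ u v vs =
  IsPath H r v vs ×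
  (∃ λ init → vs ≡ init ++ (u ∷ v ∷ [])) ×
  pathLength vs ≤ ℓ

module Submission where

-- (1) Every vertex w of H has in-degree at most k.  For an edge x w,
-- minimality makes H minus x w infeasible, so by Menger's theorem (proved here
-- with augmenting paths for 0/1 flows) fewer than k of its edges enter some
-- set X with r ∉ X containing a terminal.  Feasibility of H forces at least k
-- entering edges in H, so x w enters X and X is tight.  By submodularity of the
-- in-degree ρ the intersection of the tight sets of all edges into w still has
-- at most k entering edges, and every edge into w enters it.
-- (2) A path into y ≠ r is a path into its penultimate vertex x followed by the
-- edge x y; grouping by x gives at most k ^ j paths of length ≤ j + 1 into y.
-- Dropping the last vertex maps the paths ending with u v injectively into the
-- paths into u of length ≤ ℓ - 1.
-- Neither H nor the terminal set is decidable, so (1) is classical and is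
-- carried out in the double-negation monad; the final bound is decidable.

open import Defs
open import Level using (0ℓ)
open import Data.Nat using (ℕ; zero; suc; _≤_; _<_; _∸_; _^_; _+_; _*_; z≤n; s≤s; _≤?_)
open import Data.Nat.Properties
  using (+-*-semiring; module ≤-Reasoning; ≤-refl; ≤-reflexive; ≤-trans; ≤-pred; <⇒≱; m<n⇒m<1+n; 0≢1+n;
         +-assoc; +-comm; +-suc; +-identityʳ; m≤m+n; m≤n+m; +-mono-≤; +-monoʳ-≤; +-cancelˡ-≡; +-cancelʳ-≡; +-cancelʳ-≤;
         *-comm; *-identityˡ; *-identityʳ; *-zeroʳ; *-distribˡ-+; *-mono-≤; *-monoʳ-≤)
open import Data.Nat.Tactic.RingSolver using (solve-∀)
open import Data.Fin using (Fin; zero; suc; _≟_)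
open import Data.Bool using (Bool; true; false; _∧_; _∨_; not)
open import Data.Bool.Properties using (∧-zeroʳ)
open import Data.List using (List; []; _∷_; _++_; _∷ʳ_; length; map; filter; allFin; tabulate)
open import Data.List.Relation.Unary.Unique.Propositional using (Unique)
open import Data.List.Relation.Unary.All as All using (All; []; _∷_)
open import Data.List.Relation.Unary.AllPairs using ([]; _∷_)
open import Data.List.Relation.Unary.Any using (here; there)
open import Data.List.Membership.Propositional using (_∈_; _∉_)
open import Data.Product using (Σ-syntax; ∃; _×_; _,_; proj₁; proj₂)
open import Data.Sum using (_⊎_; inj₁; inj₂; [_,_]′)
open import Data.Vec using (Vec; []; _∷_; lookup)
open import Function using (_∘_)
open import Function.Bundles using (_⇔_; mk⇔; Equivalence)
open import Relation.Nullary using (¬_; Dec; yes; no; does)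
open import Relation.Nullary.Decidable using (dec-true; dec-false; decidable-stable; ¬¬-excluded-middle; _×-dec_; ¬?)
open import Relation.Nullary.Negation using (¬¬-Monad; contradiction)
open import Effect.Monad using (RawMonad)
open import Relation.Binary.PropositionalEquality
open import Algebra.Properties.Semiring.Sum +-*-semiring
  using (sum; sum-syntax; sum-cong-≗; ∑-distrib-+; ∑-comm; *-distribˡ-sum)
import Data.List.Properties as List
open import Data.List.Properties using (∷-injective)
import Data.List.Relation.Unary.All.Properties as All
import Data.List.Relation.Unary.Unique.Propositional.Properties as Unique
import Data.List.Membership.DecPropositional as DecMembership
open import Data.List.Membership.Propositional.Properties using (∈-++⁺ʳ; ∈-filter⁺; ∈-filter⁻; ∈-allFin)

open RawMonad (¬¬-Monad {a = 0ℓ}) using (pure; _>>=_)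

⟦_⟧ : Bool → ℕ
⟦ true ⟧ = 1
⟦ false ⟧ = 0

δ : ∀ {n} → Fin n → Fin n → ℕ
δ i j = ⟦ does (i ≟ j) ⟧

does⇒ : ∀ {P : Set} (P? : Dec P) → does P? ≡ true → P
does⇒ (yes p) _ = p

δ-refl : ∀ {n} (i : Fin n) → δ i i ≡ 1
δ-refl i = cong ⟦_⟧ (dec-true (i ≟ i) refl)

δ-≢ : ∀ {n} {i j : Fin n} → i ≢ j → δ i j ≡ 0
δ-≢ {i = i} {j} i≢j = cong ⟦_⟧ (dec-false (i ≟ j) i≢j)

δ≤1 : ∀ {n} (i j : Fin n) → δ i j ≤ 1
δ≤1 i j with does (i ≟ j)
... | true = ≤-refl
... | false = z≤n

sum-mono : ∀ {n} {f g : Fin n → ℕ} → (∀ i → f i ≤ g i) → sum f ≤ sum g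
sum-mono {zero} _ = z≤n
sum-mono {suc n} f≤g = +-mono-≤ (f≤g zero) (sum-mono (f≤g ∘ suc))

sum-zero : ∀ {n} {f : Fin n → ℕ} → (∀ i → f i ≡ 0) → sum f ≡ 0
sum-zero {zero} _ = refl
sum-zero {suc n} f≡0 rewrite f≡0 zero = sum-zero (f≡0 ∘ suc)

term≤sum : ∀ {n} (f : Fin n → ℕ) (i : Fin n) → f i ≤ sum f
term≤sum f zero = m≤m+n (f zero) _
term≤sum f (suc i) = ≤-trans (term≤sum (f ∘ suc) i) (m≤n+m _ (f zero))

δ-sift : ∀ {n} (j : Fin n) (f : Fin n → ℕ) → ∑[ i < n ] (δ i j * f i) ≡ f j
δ-sift {suc n} zero f = begin
  f zero + 0 + ∑[ i < n ] (δ (suc i) zero * f (suc i)) ≡⟨ cong (f zero + 0 +_) (sum-zero {n} λ _ → refl) ⟩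
  f zero + 0 + 0                                      ≡⟨ trans (+-identityʳ _) (+-identityʳ _) ⟩
  f zero                                              ∎
  where open ≡-Reasoning
δ-sift {suc n} (suc j) f = δ-sift j (f ∘ suc)

δ-sum : ∀ {n} (j : Fin n) → ∑[ i < n ] δ i j ≡ 1
δ-sum j = trans (sum-cong-≗ (λ i → sym (*-identityʳ (δ i j)))) (δ-sift j (λ _ → 1))

∑∑ : ∀ {n} → (Fin n → Fin n → ℕ) → ℕ
∑∑ F = sum (λ a → sum (F a))

∑∑-mono : ∀ {n} {F G : Fin n → Fin n → ℕ} → (∀ a b → F a b ≤ G a b) → ∑∑ F ≤ ∑∑ G
∑∑-mono F≤G = sum-mono (λ a → sum-mono (F≤G a))

∑∑-distrib-+ : ∀ {n} (F G : Fin n → Fin n → ℕ) → ∑∑ (λ a b → F a b + G a b) ≡ ∑∑ F + ∑∑ G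
∑∑-distrib-+ F G =
  trans (sum-cong-≗ (λ a → ∑-distrib-+ (F a) (G a))) (∑-distrib-+ (λ a → sum (F a)) (λ a → sum (G a)))

∑∑-sift : ∀ {n} (x y : Fin n) (F : Fin n → Fin n → ℕ) → ∑∑ (λ a b → δ a x * δ b y * F a b) ≡ F x y
∑∑-sift x y F = begin
  ∑∑ (λ a b → δ a x * δ b y * F a b)   ≡⟨ sum-cong-≗ (λ a → sum-cong-≗ (λ b → reorder (δ a x) (δ b y) (F a b))) ⟩
  ∑∑ (λ a b → δ b y * (δ a x * F a b)) ≡⟨ sum-cong-≗ (λ a → δ-sift y (λ b → δ a x * F a b)) ⟩
  ∑[ a < _ ] (δ a x * F a y)           ≡⟨ δ-sift x (λ a → F a y) ⟩
  F x y                                ∎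
  where
  open ≡-Reasoning
  reorder : ∀ p q c → p * q * c ≡ q * (p * c)
  reorder = solve-∀

-- Neither the edge relation of the graph nor the
-- terminal set is decidable, so case distinctions are made inside the
-- double-negation monad; the final bound is a decidable statement about ℕ,
-- hence it can be extracted at the end.

¬¬-finite-choice : ∀ {n} {B : Fin n → Set} → (∀ i → ¬ ¬ B i) → ¬ ¬ (∀ i → B i)
¬¬-finite-choice {zero} _ = pure λ ()
¬¬-finite-choice {suc n} ¬¬B = do
  b₀ ← ¬¬B zero
  bs ← ¬¬-finite-choice (¬¬B ∘ suc)
  pure λ { zero → b₀ ; (suc i) → bs i }

¬¬-decide-all : ∀ {n} (B : Fin n → Set) → ¬ ¬ (∀ i → Dec (B i))
¬¬-decide-all B = ¬¬-finite-choice (λ i → ¬¬-excluded-middle)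

unique-constant : ∀ {A : Set} {c : A} ys → Unique ys → All (c ≡_) ys → length ys ≤ 1
unique-constant [] _ _ = z≤n
unique-constant (y ∷ []) _ _ = s≤s z≤n
unique-constant (y ∷ y′ ∷ ys) ((y≢y′ ∷ _) ∷ _) (refl ∷ refl ∷ _) = contradiction refl y≢y′

module _ {A : Set} where

  fibre : ∀ {n} → (A → Fin n) → Fin n → List A → List A
  fibre c i = filter (λ x → i ≟ c x)

  length-by-fibres : ∀ {n} (c : A → Fin n) xs → length xs ≡ ∑[ i < n ] length (fibre c i xs)
  length-by-fibres {n} c [] = sym (sum-zero {n} λ _ → refl)
  length-by-fibres {n} c (x ∷ xs) = begin
    1 + length xs                                              ≡⟨ cong₂ _+_ (sym (δ-sum (c x))) (length-by-fibres c xs) ⟩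
    ∑[ i < n ] δ i (c x) + ∑[ i < n ] length (fibre c i xs)    ≡⟨ ∑-distrib-+ (λ i → δ i (c x)) _ ⟨
    ∑[ i < n ] (δ i (c x) + length (fibre c i xs))             ≡⟨ sum-cong-≗ add-x ⟩
    ∑[ i < n ] length (fibre c i (x ∷ xs))                     ∎
    where
    open ≡-Reasoning
    add-x : ∀ i → δ i (c x) + length (fibre c i xs) ≡ length (fibre c i (x ∷ xs))
    add-x i with i ≟ c x
    ... | yes _ = refl
    ... | no _ = refl

  count-by-fibres : ∀ {n} {P : A → Set} (c : A → Fin n) (b : Fin n → ℕ) →
    (∀ i ys → Unique ys → All (λ y → P y × i ≡ c y) ys → length ys ≤ b i) →
    ∀ xs → Unique xs → All P xs → length xs ≤ sum b
  count-by-fibres c b fibre-bound xs xs! Pxs = begin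
    length xs                         ≡⟨ length-by-fibres c xs ⟩
    ∑[ i < _ ] length (fibre c i xs)  ≤⟨ sum-mono bound-fibre ⟩
    sum b                             ∎
    where
    open ≤-Reasoning
    bound-fibre : ∀ i → length (fibre c i xs) ≤ b i
    bound-fibre i = fibre-bound i (fibre c i xs)
      (Unique.filter⁺ (λ x → i ≟ c x) xs!)
      (All.zip (All.filter⁺ (λ x → i ≟ c x) Pxs , All.all-filter (λ x → i ≟ c x) xs))

count-distinct-pairs : ∀ {n} (w : Fin n → Fin n → ℕ) xs → Unique xs →
  All (λ e → 1 ≤ w (proj₁ e) (proj₂ e)) xs → length xs ≤ ∑∑ w
count-distinct-pairs {n} w = count-by-fibres proj₁ (λ a → sum (w a)) λ a →
  count-by-fibres proj₂ (w a) λ { b [] _ _ → z≤n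
                                ; b ys@(_ ∷ _) ys! all@(((1≤w , refl) , refl) ∷ _) →
                                    ≤-trans (unique-constant ys ys! (All.map same-pair all)) 1≤w }
  where
  same-pair : ∀ {Q : Set} {a b : Fin n} {e} → (Q × a ≡ proj₁ e) × b ≡ proj₂ e → (a , b) ≡ e
  same-pair ((_ , refl) , refl) = refl

-- Simple paths and walks in an arbitrary edge relation E on Fin n.
-- SimplePath E a c vs : the vertex list a ∷ vs is a simple E-path from a to c.

data SimplePath {n} (E : Fin n → Fin n → Set) : Fin n → Fin n → List (Fin n) → Set where
  []   : ∀ {a} → SimplePath E a a []
  step : ∀ {a b c vs} → E a b → a ∉ b ∷ vs → SimplePath E b c vs → SimplePath E a c (b ∷ vs)

data Walk {n} (E : Fin n → Fin n → Set) : Fin n → Fin n → Set where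
  []  : ∀ {a} → Walk E a a
  _∷_ : ∀ {a b c} → E a b → Walk E b c → Walk E a c

_∷ʷ_ : ∀ {n} {E : Fin n → Fin n → Set} {a b c} → Walk E a b → E b c → Walk E a c
[] ∷ʷ e = e ∷ []
(e′ ∷ w) ∷ʷ e = e′ ∷ (w ∷ʷ e)

module _ {n} {E : Fin n → Fin n → Set} where

  suffix-from : ∀ {a b c vs} → SimplePath E b c vs → a ∈ b ∷ vs → ∃ (SimplePath E a c)
  suffix-from p (here refl) = _ , p
  suffix-from (step _ _ p) (there a∈vs) = suffix-from p a∈vs

  loop-erase : ∀ {a c} → Walk E a c → ∃ (SimplePath E a c)
  loop-erase [] = _ , []
  loop-erase (_∷_ {a} {b} e w) with loop-erase w
  ... | vs , p with DecMembership._∈?_ _≟_ a (b ∷ vs)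
  ...   | yes a∈ = suffix-from p a∈
  ...   | no a∉ = _ , step e a∉ p

  simple-edges : ∀ {a c vs} → SimplePath E a c vs → All (λ e → E (proj₁ e) (proj₂ e)) (edgesOf (a ∷ vs))
  simple-edges [] = []
  simple-edges (step e _ p) = e ∷ simple-edges p

  simple-ends : ∀ {a c vs} → SimplePath E a c vs → ∃ λ init → a ∷ vs ≡ init ++ c ∷ []
  simple-ends [] = [] , refl
  simple-ends {a} (step _ _ p) with simple-ends p
  ... | init , eq = a ∷ init , cong (a ∷_) eq

  simple-unique : ∀ {a c vs} → SimplePath E a c vs → Unique (a ∷ vs)
  simple-unique [] = [] ∷ []
  simple-unique (step {vs = vs} _ a∉ p) = All.¬Any⇒All¬ (_ ∷ vs) a∉ ∷ simple-unique p

  simple-isPath : ∀ (G : Digraph n) {a c vs} → (∀ {x y} → E x y → G x y) → SimplePath E a c vs →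
    IsPath G a c (a ∷ vs)
  simple-isPath G {vs = vs} E⊆G p = record
    { starts = vs , refl
    ; ends = simple-ends p
    ; inGraph = All.map E⊆G (simple-edges p)
    ; distinct = simple-unique p }

-- Step counts.  stepCount vs a b is the number of consecutive pairs (a , b) in
-- the vertex list vs; along a simple path it is the 0/1 indicator of the edges
-- of the path, and summing it over a vertex gives flow conservation.

positive : ℕ → Bool
positive zero = false
positive (suc _) = true

⟦positive⟧ : ∀ {m} → m ≤ 1 → ⟦ positive m ⟧ ≡ m
⟦positive⟧ z≤n = refl
⟦positive⟧ (s≤s z≤n) = refl

positive⇒1≤ : ∀ {m} → positive m ≡ true → 1 ≤ m
positive⇒1≤ {suc _} _ = s≤s z≤n

1≤⇒positive : ∀ {m} → 1 ≤ m → positive m ≡ true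
1≤⇒positive (s≤s _) = refl

module _ {n : ℕ} where

  stepCount : List (Fin n) → Fin n → Fin n → ℕ
  stepCount (x ∷ y ∷ vs) a b = δ a x * δ b y + stepCount (y ∷ vs) a b
  stepCount _ a b = 0

  first-step-or-later : ∀ {a x b y : Fin n} m → 1 ≤ δ a x * δ b y + m → (a ≡ x × b ≡ y) ⊎ 1 ≤ m
  first-step-or-later {a} {x} {b} {y} m 1≤ with a ≟ x | b ≟ y
  ... | yes a≡x | yes b≡y = inj₁ (a≡x , b≡y)
  ... | yes _ | no _ = inj₂ 1≤
  ... | no _ | _ = inj₂ 1≤

  stepCount⇒edge : ∀ vs {a b} → 1 ≤ stepCount vs a b → (a , b) ∈ edgesOf vs
  stepCount⇒edge (x ∷ y ∷ vs) {a} {b} 1≤count =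
    [ (λ { (refl , refl) → here refl }) , there ∘ stepCount⇒edge (y ∷ vs) ]′
      (first-step-or-later {a} {x} {b} {y} _ 1≤count)

  edge⇒stepCount : ∀ vs {a b} → (a , b) ∈ edgesOf vs → 1 ≤ stepCount vs a b
  edge⇒stepCount (x ∷ y ∷ vs) (here refl) rewrite δ-refl x | δ-refl y = s≤s z≤n
  edge⇒stepCount (x ∷ y ∷ vs) {a} {b} (there ab∈) =
    ≤-trans (edge⇒stepCount (y ∷ vs) ab∈) (m≤n+m _ (δ a x * δ b y))

  stepCount-∉ : ∀ vs {a} b → a ∉ vs → stepCount vs a b ≡ 0
  stepCount-∉ (x ∷ y ∷ vs) {a} b a∉ =
    trans (cong (λ d → d * δ b y + stepCount (y ∷ vs) a b) (δ-≢ (a∉ ∘ here)))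
          (stepCount-∉ (y ∷ vs) b (a∉ ∘ there))
  stepCount-∉ (x ∷ []) b _ = refl
  stepCount-∉ [] b _ = refl

  simple-stepCount≤1 : ∀ {E : Fin n → Fin n → Set} {a c vs} → SimplePath E a c vs →
    ∀ x y → stepCount (a ∷ vs) x y ≤ 1
  simple-stepCount≤1 [] x y = z≤n
  simple-stepCount≤1 {a = a} (step {b = b} {vs = vs} _ a∉ p) x y with x ≟ a
  ... | yes refl = begin
    1 * δ y b + stepCount (b ∷ vs) x y  ≡⟨ cong (1 * δ y b +_) (stepCount-∉ (b ∷ vs) y a∉) ⟩
    1 * δ y b + 0                       ≡⟨ trans (+-identityʳ _) (*-identityˡ _) ⟩
    δ y b                               ≤⟨ δ≤1 y b ⟩
    1                                   ∎
    where open ≤-Reasoning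
  ... | no _ = simple-stepCount≤1 p x y

  out-steps in-steps : List (Fin n) → Fin n → ℕ
  out-steps vs v = ∑[ x < n ] stepCount vs v x
  in-steps vs v = ∑[ x < n ] stepCount vs x v

  out-steps-∷ : ∀ a b vs v → out-steps (a ∷ b ∷ vs) v ≡ δ v a + out-steps (b ∷ vs) v
  out-steps-∷ a b vs v = begin
    ∑[ x < n ] (δ v a * δ x b + stepCount (b ∷ vs) v x)  ≡⟨ ∑-distrib-+ (λ x → δ v a * δ x b) _ ⟩
    ∑[ x < n ] (δ v a * δ x b) + out-steps (b ∷ vs) v    ≡⟨ cong (_+ out-steps (b ∷ vs) v) first-step ⟩
    δ v a + out-steps (b ∷ vs) v                         ∎
    where
    open ≡-Reasoning
    first-step : ∑[ x < n ] (δ v a * δ x b) ≡ δ v a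
    first-step = begin
      ∑[ x < n ] (δ v a * δ x b)  ≡⟨ *-distribˡ-sum (δ v a) (λ x → δ x b) ⟨
      δ v a * ∑[ x < n ] δ x b    ≡⟨ cong (δ v a *_) (δ-sum b) ⟩
      δ v a * 1                   ≡⟨ *-identityʳ _ ⟩
      δ v a                       ∎

  in-steps-∷ : ∀ a b vs v → in-steps (a ∷ b ∷ vs) v ≡ δ v b + in-steps (b ∷ vs) v
  in-steps-∷ a b vs v =
    trans (∑-distrib-+ (λ x → δ x a * δ v b) _) (cong (_+ in-steps (b ∷ vs) v) (δ-sift a (λ _ → δ v b)))

  step-balance : ∀ {E : Fin n → Fin n → Set} {a c vs} → SimplePath E a c vs →
    ∀ v → out-steps (a ∷ vs) v + δ v c ≡ in-steps (a ∷ vs) v + δ v a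
  step-balance [] v = refl
  step-balance {a = a} {c} (step {b = b} {vs = vs} _ _ p) v = begin
    out-steps (a ∷ b ∷ vs) v + δ v c        ≡⟨ cong (_+ δ v c) (out-steps-∷ a b vs v) ⟩
    δ v a + out-steps (b ∷ vs) v + δ v c    ≡⟨ +-assoc (δ v a) _ _ ⟩
    δ v a + (out-steps (b ∷ vs) v + δ v c)  ≡⟨ cong (δ v a +_) (step-balance p v) ⟩
    δ v a + (in-steps (b ∷ vs) v + δ v b)   ≡⟨ swap (δ v a) _ (δ v b) ⟩
    δ v b + in-steps (b ∷ vs) v + δ v a     ≡⟨ cong (_+ δ v a) (in-steps-∷ a b vs v) ⟨
    in-steps (a ∷ b ∷ vs) v + δ v a         ∎
    where
    open ≡-Reasoning
    swap : ∀ x y z → x + (y + z) ≡ z + y + x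
    swap = solve-∀

-- Edge sets are Boolean relations and vertex sets Boolean
-- predicates.  A flow is an edge set f carrying one unit on each of its edges;
-- between f S S′ counts the f-edges from S to S′, and ρ g X counts the g-edges
-- entering X (the in-degree of X, written ρ in the paper).

BoolRel : ℕ → Set
BoolRel n = Fin n → Fin n → Bool

module _ {n : ℕ} where

  out-degree in-degree : BoolRel n → Fin n → ℕ
  out-degree f v = ∑[ b < n ] ⟦ f v b ⟧
  in-degree f v = ∑[ a < n ] ⟦ f a v ⟧

  Conserves : BoolRel n → Fin n → Fin n → ℕ → Set
  Conserves f r t j = ∀ v → out-degree f v + δ v t * j ≡ in-degree f v + δ v r * j

  between : BoolRel n → (Fin n → Bool) → (Fin n → Bool) → ℕ
  between f S S′ = ∑∑ (λ a b → ⟦ f a b ∧ S a ∧ S′ b ⟧)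

  ρ : BoolRel n → (Fin n → Bool) → ℕ
  ρ g X = between g (not ∘ X) X

  split-by-tail : ∀ s s′ e → ⟦ s ⟧ * ⟦ e ⟧ ≡ ⟦ e ∧ s ∧ s′ ⟧ + ⟦ e ∧ s ∧ not s′ ⟧
  split-by-tail true true true = refl
  split-by-tail true false true = refl
  split-by-tail false s′ true = refl
  split-by-tail s s′ false = *-zeroʳ ⟦ s ⟧

  split-by-head : ∀ s s′ e → ⟦ s′ ⟧ * ⟦ e ⟧ ≡ ⟦ e ∧ s ∧ s′ ⟧ + ⟦ e ∧ not s ∧ s′ ⟧
  split-by-head true s′ true = trans (*-identityʳ ⟦ s′ ⟧) (sym (+-identityʳ ⟦ s′ ⟧))
  split-by-head false s′ true = *-identityʳ ⟦ s′ ⟧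
  split-by-head s s′ false = *-zeroʳ ⟦ s′ ⟧

  out-of-set : ∀ f (S : Fin n → Bool) →
    ∑[ v < n ] (⟦ S v ⟧ * out-degree f v) ≡ between f S S + between f S (not ∘ S)
  out-of-set f S = begin
    ∑[ v < n ] (⟦ S v ⟧ * out-degree f v)    ≡⟨ sum-cong-≗ (λ v → *-distribˡ-sum ⟦ S v ⟧ (λ b → ⟦ f v b ⟧)) ⟩
    ∑∑ (λ v b → ⟦ S v ⟧ * ⟦ f v b ⟧)         ≡⟨ sum-cong-≗ (λ v → sum-cong-≗ (λ b → split-by-tail (S v) (S b) (f v b))) ⟩
    ∑∑ (λ v b → ⟦ f v b ∧ S v ∧ S b ⟧ + ⟦ f v b ∧ S v ∧ not (S b) ⟧)
                                             ≡⟨ ∑∑-distrib-+ (λ v b → ⟦ f v b ∧ S v ∧ S b ⟧) _ ⟩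
    between f S S + between f S (not ∘ S)    ∎
    where open ≡-Reasoning

  into-set : ∀ f (S : Fin n → Bool) →
    ∑[ v < n ] (⟦ S v ⟧ * in-degree f v) ≡ between f S S + between f (not ∘ S) S
  into-set f S = begin
    ∑[ v < n ] (⟦ S v ⟧ * in-degree f v)     ≡⟨ sum-cong-≗ (λ v → *-distribˡ-sum ⟦ S v ⟧ (λ a → ⟦ f a v ⟧)) ⟩
    ∑∑ (λ v a → ⟦ S v ⟧ * ⟦ f a v ⟧)         ≡⟨ sum-cong-≗ (λ v → sum-cong-≗ (λ a → split-by-head (S a) (S v) (f a v))) ⟩
    ∑∑ (λ v a → ⟦ f a v ∧ S a ∧ S v ⟧ + ⟦ f a v ∧ not (S a) ∧ S v ⟧)
                                             ≡⟨ ∑-comm (λ v a → ⟦ f a v ∧ S a ∧ S v ⟧ + ⟦ f a v ∧ not (S a) ∧ S v ⟧) ⟩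
    ∑∑ (λ a v → ⟦ f a v ∧ S a ∧ S v ⟧ + ⟦ f a v ∧ not (S a) ∧ S v ⟧)
                                             ≡⟨ ∑∑-distrib-+ (λ a v → ⟦ f a v ∧ S a ∧ S v ⟧) _ ⟩
    between f S S + between f (not ∘ S) S    ∎
    where open ≡-Reasoning

  at-terminal : ∀ (S : Fin n → Bool) c j → ∑[ v < n ] (⟦ S v ⟧ * (δ v c * j)) ≡ ⟦ S c ⟧ * j
  at-terminal S c j =
    trans (sum-cong-≗ (λ v → reorder ⟦ S v ⟧ (δ v c) j)) (δ-sift c (λ v → ⟦ S v ⟧ * j))
    where
    reorder : ∀ x y z → x * (y * z) ≡ y * (x * z)
    reorder = solve-∀

  restricted-sum : ∀ (S : Fin n → Bool) (x y : Fin n → ℕ) →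
    ∑[ v < n ] (⟦ S v ⟧ * (x v + y v)) ≡ ∑[ v < n ] (⟦ S v ⟧ * x v) + ∑[ v < n ] (⟦ S v ⟧ * y v)
  restricted-sum S x y =
    trans (sum-cong-≗ (λ v → *-distribˡ-+ ⟦ S v ⟧ (x v) (y v))) (∑-distrib-+ (λ v → ⟦ S v ⟧ * x v) _)

  cut-balance : ∀ {f r t j} → Conserves f r t j → ∀ S →
    between f S (not ∘ S) + ⟦ S t ⟧ * j ≡ between f (not ∘ S) S + ⟦ S r ⟧ * j
  cut-balance {f} {r} {t} {j} conserves S = +-cancelˡ-≡ (between f S S) _ _ (begin
    between f S S + (between f S (not ∘ S) + ⟦ S t ⟧ * j)
      ≡⟨ +-assoc (between f S S) _ _ ⟨
    between f S S + between f S (not ∘ S) + ⟦ S t ⟧ * j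
      ≡⟨ cong₂ _+_ (out-of-set f S) (at-terminal S t j) ⟨
    ∑[ v < n ] (⟦ S v ⟧ * out-degree f v) + ∑[ v < n ] (⟦ S v ⟧ * (δ v t * j))
      ≡⟨ restricted-sum S (out-degree f) (λ v → δ v t * j) ⟨
    ∑[ v < n ] (⟦ S v ⟧ * (out-degree f v + δ v t * j))
      ≡⟨ sum-cong-≗ (λ v → cong (⟦ S v ⟧ *_) (conserves v)) ⟩
    ∑[ v < n ] (⟦ S v ⟧ * (in-degree f v + δ v r * j))
      ≡⟨ restricted-sum S (in-degree f) (λ v → δ v r * j) ⟩
    ∑[ v < n ] (⟦ S v ⟧ * in-degree f v) + ∑[ v < n ] (⟦ S v ⟧ * (δ v r * j))
      ≡⟨ cong₂ _+_ (into-set f S) (at-terminal S r j) ⟩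
    between f S S + between f (not ∘ S) S + ⟦ S r ⟧ * j
      ≡⟨ +-assoc (between f S S) _ _ ⟩
    between f S S + (between f (not ∘ S) S + ⟦ S r ⟧ * j) ∎)
    where open ≡-Reasoning

  shift-equation : ∀ {a b a′ b′ w z} → a′ + w ≡ a + z → b′ + w ≡ b + z → (a ≡ b) ⇔ (a′ ≡ b′)
  shift-equation {a} {b} {a′} {b′} {w} {z} a-shift b-shift = mk⇔
    (λ a≡b → +-cancelʳ-≡ w a′ b′ (trans a-shift (trans (cong (_+ z) a≡b) (sym b-shift))))
    (λ a′≡b′ → +-cancelʳ-≡ z a b (trans (sym a-shift) (trans (cong (_+ w) a′≡b′) b-shift)))

  -- If f′ arises from f by adding the weights A and
  -- removing the weights B, and A together with the reverse of B traces a
  -- simple r-t path, then f′ is a flow of value j+1 exactly when f is one of value j.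
  exchange : ∀ {E : Fin n → Fin n → Set} {r t vs} → SimplePath E r t vs →
    (f f′ : BoolRel n) (A B : Fin n → Fin n → ℕ) →
    (∀ a b → ⟦ f′ a b ⟧ + B a b ≡ ⟦ f a b ⟧ + A a b) →
    (∀ a b → A a b + B b a ≡ stepCount (r ∷ vs) a b) →
    ∀ j → Conserves f r t j ⇔ Conserves f′ r t (suc j)
  exchange {r = r} {t} {vs} path f f′ A B f′+B≡f+A A+Bᵀ≡path j =
    mk⇔ (λ conserves v → Equivalence.to (at v) (conserves v))
        (λ conserves′ v → Equivalence.from (at v) (conserves′ v))
    where
    regroup : ∀ x y z c j → x + c * suc j + (y + z) ≡ (x + y) + (z + c + c * j)
    regroup = solve-∀
    collect : ∀ x y z c j → (x + y) + (z + c + c * j) ≡ x + c * j + (y + z + c)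
    collect = solve-∀

    at : ∀ v → (out-degree f v + δ v t * j ≡ in-degree f v + δ v r * j) ⇔
               (out-degree f′ v + δ v t * suc j ≡ in-degree f′ v + δ v r * suc j)
    at v = shift-equation out-shift in-shift
      where
      oA oB iA iB : ℕ
      oA = ∑[ b < n ] A v b
      oB = ∑[ b < n ] B v b
      iA = ∑[ a < n ] A a v
      iB = ∑[ a < n ] B a v
      T R : ℕ
      T = δ v t
      R = δ v r

      out-exchange : out-degree f′ v + oB ≡ out-degree f v + oA
      out-exchange = trans (sym (∑-distrib-+ (λ b → ⟦ f′ v b ⟧) (B v)))
        (trans (sum-cong-≗ (f′+B≡f+A v)) (∑-distrib-+ (λ b → ⟦ f v b ⟧) (A v)))
      in-exchange : in-degree f′ v + iB ≡ in-degree f v + iA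
      in-exchange = trans (sym (∑-distrib-+ (λ a → ⟦ f′ a v ⟧) (λ a → B a v)))
        (trans (sum-cong-≗ (λ a → f′+B≡f+A a v)) (∑-distrib-+ (λ a → ⟦ f a v ⟧) (λ a → A a v)))
      path-out : oA + iB ≡ out-steps (r ∷ vs) v
      path-out = trans (sym (∑-distrib-+ (A v) (λ b → B b v))) (sum-cong-≗ (A+Bᵀ≡path v))
      path-in : iA + oB ≡ in-steps (r ∷ vs) v
      path-in = trans (sym (∑-distrib-+ (λ a → A a v) (B v))) (sum-cong-≗ (λ a → A+Bᵀ≡path a v))

      open ≡-Reasoning
      out-shift : out-degree f′ v + T * suc j + (oB + iB) ≡ out-degree f v + T * j + (out-steps (r ∷ vs) v + T)
      out-shift = begin
        out-degree f′ v + T * suc j + (oB + iB)      ≡⟨ regroup (out-degree f′ v) oB iB T j ⟩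
        out-degree f′ v + oB + (iB + T + T * j)      ≡⟨ cong (_+ (iB + T + T * j)) out-exchange ⟩
        out-degree f v + oA + (iB + T + T * j)       ≡⟨ collect (out-degree f v) oA iB T j ⟩
        out-degree f v + T * j + (oA + iB + T)       ≡⟨ cong (λ p → out-degree f v + T * j + (p + T)) path-out ⟩
        out-degree f v + T * j + (out-steps (r ∷ vs) v + T) ∎
      in-shift : in-degree f′ v + R * suc j + (oB + iB) ≡ in-degree f v + R * j + (out-steps (r ∷ vs) v + T)
      in-shift = begin
        in-degree f′ v + R * suc j + (oB + iB)       ≡⟨ cong (in-degree f′ v + R * suc j +_) (+-comm oB iB) ⟩
        in-degree f′ v + R * suc j + (iB + oB)       ≡⟨ regroup (in-degree f′ v) iB oB R j ⟩
        in-degree f′ v + iB + (oB + R + R * j)       ≡⟨ cong (_+ (oB + R + R * j)) in-exchange ⟩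
        in-degree f v + iA + (oB + R + R * j)        ≡⟨ collect (in-degree f v) iA oB R j ⟩
        in-degree f v + R * j + (iA + oB + R)        ≡⟨ cong (λ p → in-degree f v + R * j + (p + R)) path-in ⟩
        in-degree f v + R * j + (in-steps (r ∷ vs) v + R) ≡⟨ cong (in-degree f v + R * j +_) (step-balance path v) ⟨
        in-degree f v + R * j + (out-steps (r ∷ vs) v + T) ∎

∧-true : ∀ {x y} → x ∧ y ≡ true → x ≡ true × y ≡ true
∧-true {true} y≡true = refl , y≡true

not-true : ∀ {x} → not x ≡ true → x ≡ false
not-true {false} _ = refl

add-and-cancel : ∀ e add cancel → (add ≡ true → e ≡ false) → (cancel ≡ true → e ≡ true) →
  ⟦ (e ∧ not cancel) ∨ add ⟧ + ⟦ cancel ⟧ ≡ ⟦ e ⟧ + ⟦ add ⟧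
add-and-cancel true true _ add⇒¬e _ with add⇒¬e refl
... | ()
add-and-cancel true false true _ _ = refl
add-and-cancel true false false _ _ = refl
add-and-cancel false add true _ cancel⇒e with cancel⇒e refl
... | ()
add-and-cancel false true false _ _ = refl
add-and-cancel false false false _ _ = refl

split-on : ∀ s x → ⟦ s ∧ not x ⟧ + ⟦ s ∧ x ⟧ ≡ ⟦ s ⟧
split-on true true = refl
split-on true false = refl
split-on false x = refl

take-away : ∀ e s → (s ≡ true → e ≡ true) → ⟦ e ⟧ + 0 ≡ ⟦ e ∧ not s ⟧ + ⟦ s ⟧
take-away true true _ = refl
take-away true false _ = refl
take-away false true s⇒e with s⇒e refl
... | ()
take-away false false _ = refl

no-edge-into : ∀ e x y → (e ≡ true → y ≡ true → x ≡ true) → ⟦ e ∧ not x ∧ y ⟧ ≡ 0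
no-edge-into true false true closed with closed refl refl
... | ()
no-edge-into true false false _ = refl
no-edge-into true true y _ = refl
no-edge-into false x y _ = refl

no-edge-out-of : ∀ e x y → (e ≡ true → x ≡ true → y ≡ true) → ⟦ e ∧ x ∧ not y ⟧ ≡ 0
no-edge-out-of true true false closed with closed refl refl
... | ()
no-edge-out-of true true true _ = refl
no-edge-out-of true false y _ = refl
no-edge-out-of false x y _ = refl

leaving-edge : ∀ g e x y → (g ≡ true → x ≡ true → y ≡ false → e ≡ true) →
  ⟦ g ∧ not (not x) ∧ not y ⟧ ≤ ⟦ e ∧ x ∧ not y ⟧
leaving-edge true e true false forced rewrite forced refl refl refl = ≤-refl
leaving-edge true e true true _ = z≤n
leaving-edge true e false y _ = z≤n
leaving-edge false e x y _ = z≤n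

module Menger {n} (G : Digraph n) (G? : ∀ a b → Dec (G a b)) (r t : Fin n) where

  g : BoolRel n
  g a b = does (G? a b)

  record Flow (j : ℕ) : Set where
    field
      edges : BoolRel n
      within : ∀ {a b} → edges a b ≡ true → g a b ≡ true
      conserves : Conserves edges r t j
  open Flow

  FlowEdge : BoolRel n → Fin n → Fin n → Set
  FlowEdge f a b = f a b ≡ true

  Residual : BoolRel n → Fin n → Fin n → Set
  Residual f a b = f b a ≡ true ⊎ (g a b ≡ true × f a b ≡ false)

  SmallCut : ℕ → Set
  SmallCut m = Σ[ X ∈ (Fin n → Bool) ] (X r ≡ false × X t ≡ true × ρ g X < m)

  empty-flow : Flow 0
  empty-flow = record
    { edges = λ _ _ → false
    ; within = λ ()
    ; conserves = λ v → trans (no-flow (δ v t)) (sym (no-flow (δ v r))) }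
    where
    no-flow : ∀ d → ∑[ b < n ] 0 + d * 0 ≡ 0
    no-flow d = cong₂ _+_ (sum-zero {n} λ _ → refl) (*-zeroʳ d)

  module OnPath {E : Fin n → Fin n → Set} {vs} (path : SimplePath E r t vs) where
    on : BoolRel n
    on a b = positive (stepCount (r ∷ vs) a b)

    ⟦on⟧ : ∀ a b → ⟦ on a b ⟧ ≡ stepCount (r ∷ vs) a b
    ⟦on⟧ a b = ⟦positive⟧ (simple-stepCount≤1 path a b)

    on⇒E : ∀ {a b} → on a b ≡ true → E a b
    on⇒E on-ab = All.lookup (simple-edges path) (stepCount⇒edge (r ∷ vs) (positive⇒1≤ on-ab))

    off⇒not-edge : ∀ {a b} → on a b ≡ false → (a , b) ∉ edgesOf (r ∷ vs)
    off⇒not-edge {a} {b} off ab∈ with trans (sym (1≤⇒positive (edge⇒stepCount (r ∷ vs) ab∈))) off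
    ... | ()

  augment : ∀ {j vs} (F : Flow j) → SimplePath (Residual (edges F)) r t vs → Flow (suc j)
  augment {j} {vs} F path = record
    { edges = f′
    ; within = within′
    ; conserves = Equivalence.to (exchange path f f′ (λ a b → ⟦ forward a b ⟧) (λ a b → ⟦ backward a b ⟧)
                                            exchanged traces-path j)
                                 (conserves F) }
    where
    open OnPath path
    f : BoolRel n
    f = edges F
    forward backward f′ : BoolRel n
    forward a b = on a b ∧ not (f b a)
    backward a b = on b a ∧ f a b
    f′ a b = (f a b ∧ not (backward a b)) ∨ forward a b

    forward-residual : ∀ {a b} → forward a b ≡ true → g a b ≡ true × f a b ≡ false
    forward-residual fw with ∧-true fw
    ... | on-ab , not-fba with on⇒E on-ab
    ...   | inj₂ unused = unused
    ...   | inj₁ fba = contradiction (trans (sym fba) (not-true not-fba)) λ ()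

    exchanged : ∀ a b → ⟦ f′ a b ⟧ + ⟦ backward a b ⟧ ≡ ⟦ f a b ⟧ + ⟦ forward a b ⟧
    exchanged a b = add-and-cancel (f a b) _ _ (proj₂ ∘ forward-residual) (proj₂ ∘ ∧-true)

    traces-path : ∀ a b → ⟦ forward a b ⟧ + ⟦ backward b a ⟧ ≡ stepCount (r ∷ vs) a b
    traces-path a b = trans (split-on (on a b) (f b a)) (⟦on⟧ a b)

    within′ : ∀ {a b} → f′ a b ≡ true → g a b ≡ true
    within′ {a} {b} f′ab with f a b ∧ not (backward a b) in kept
    ... | true = within F (proj₁ (∧-true kept))
    ... | false = proj₁ (forward-residual f′ab)

  remove : ∀ {j vs} (F : Flow (suc j)) → SimplePath (FlowEdge (edges F)) r t vs →
    Σ[ F′ ∈ Flow j ] (∀ {a b} → edges F′ a b ≡ true → edges F a b ≡ true × (a , b) ∉ edgesOf (r ∷ vs))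
  remove {j} {vs} F path = F′ , kept
    where
    open OnPath path
    f f′ : BoolRel n
    f = edges F
    f′ a b = f a b ∧ not (on a b)

    F′ : Flow j
    F′ = record
      { edges = f′
      ; within = within F ∘ proj₁ ∘ ∧-true
      ; conserves = Equivalence.from (exchange path f′ f (stepCount (r ∷ vs)) (λ _ _ → 0)
                                                 restored (λ a b → +-identityʳ _) j)
                                     (conserves F) }
      where
      restored : ∀ a b → ⟦ f a b ⟧ + 0 ≡ ⟦ f′ a b ⟧ + stepCount (r ∷ vs) a b
      restored a b = trans (take-away (f a b) (on a b) on⇒E) (cong (⟦ f′ a b ⟧ +_) (⟦on⟧ a b))

    kept : ∀ {a b} → f′ a b ≡ true → f a b ≡ true × (a , b) ∉ edgesOf (r ∷ vs)
    kept f′ab with ∧-true f′ab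
    ... | fab , off = fab , off⇒not-edge (not-true off)

  module Reachable (E : Fin n → Fin n → Set) (reach? : ∀ v → Dec (Walk E r v)) where
    R : Fin n → Bool
    R v = does (reach? v)

    root : R r ≡ true
    root = dec-true (reach? r) []

    closed : ∀ {a b} → E a b → R a ≡ true → R b ≡ true
    closed {a} {b} e Ra = dec-true (reach? b) (does⇒ (reach? a) Ra ∷ʷ e)

    unreached : ¬ Walk E r t → R t ≡ false
    unreached = dec-false (reach? t)

  -- either the flow can be augmented, or the vertices not reachable in the
  -- residual graph form a cut with at most j entering edges
  augment-or-cut : ∀ {j} → Flow j → ¬ ¬ (Flow (suc j) ⊎ SmallCut (suc j))
  augment-or-cut {j} F = do
    reach? ← ¬¬-decide-all (Walk (Residual f) r)
    pure (case (reach? t) reach?)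
    where
    f : BoolRel n
    f = edges F
    case : Dec (Walk (Residual f) r t) → (∀ v → Dec (Walk (Residual f) r v)) → Flow (suc j) ⊎ SmallCut (suc j)
    case (yes walk) _ = inj₁ (augment F (proj₂ (loop-erase walk)))
    case (no no-walk) reach? = inj₂ (not ∘ R , cong not root , cong not (unreached no-walk) , s≤s ρ≤j)
      where
      open Reachable (Residual f) reach?

      nothing-back : between f (not ∘ R) R ≡ 0
      nothing-back = sum-zero λ a → sum-zero λ b →
        no-edge-into (f a b) (R a) (R b) (λ fab Rb → closed (inj₁ fab) Rb)

      flow-out : between f R (not ∘ R) ≡ j
      flow-out = begin
        between f R (not ∘ R)                     ≡⟨ +-identityʳ _ ⟨
        between f R (not ∘ R) + ⟦ false ⟧ * j     ≡⟨ cong (λ x → between f R (not ∘ R) + ⟦ x ⟧ * j) (unreached no-walk) ⟨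
        between f R (not ∘ R) + ⟦ R t ⟧ * j       ≡⟨ cut-balance (conserves F) R ⟩
        between f (not ∘ R) R + ⟦ R r ⟧ * j       ≡⟨ cong₂ (λ x y → x + ⟦ y ⟧ * j) nothing-back root ⟩
        1 * j                                     ≡⟨ *-identityˡ j ⟩
        j                                         ∎
        where open ≡-Reasoning

      saturated : ∀ a b → g a b ≡ true → R a ≡ true → R b ≡ false → f a b ≡ true
      saturated a b gab Ra Rb with f a b in fab
      ... | true = refl
      ... | false with trans (sym (closed (inj₂ (gab , fab)) Ra)) Rb
      ...   | ()

      ρ≤j : ρ g (not ∘ R) ≤ j
      ρ≤j = ≤-trans (∑∑-mono (λ a b → leaving-edge (g a b) (f a b) (R a) (R b) (saturated a b)))
                    (≤-reflexive flow-out)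

  flow-path : ∀ {j} (F : Flow (suc j)) → ¬ ¬ ∃ (SimplePath (FlowEdge (edges F)) r t)
  flow-path {j} F = do
    reach? ← ¬¬-decide-all (Walk (FlowEdge f) r)
    case (reach? t) reach?
    where
    f : BoolRel n
    f = edges F
    case : Dec (Walk (FlowEdge f) r t) → (∀ v → Dec (Walk (FlowEdge f) r v)) →
      ¬ ¬ ∃ (SimplePath (FlowEdge f) r t)
    case (yes walk) _ = pure (loop-erase walk)
    case (no no-walk) reach? _ = 0≢1+n flow-value-vanishes
      where
      open Reachable (FlowEdge f) reach?
      nothing-out : between f R (not ∘ R) ≡ 0
      nothing-out = sum-zero λ a → sum-zero λ b →
        no-edge-out-of (f a b) (R a) (R b) closed

      -- by cut-balance, the positive value j+1 would have to leave the closed set R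
      flow-value-vanishes : 0 ≡ suc (between f (not ∘ R) R + j)
      flow-value-vanishes = begin
        0                                          ≡⟨ cong₂ (λ x y → x + ⟦ y ⟧ * suc j) nothing-out (unreached no-walk) ⟨
        between f R (not ∘ R) + ⟦ R t ⟧ * suc j    ≡⟨ cut-balance (conserves F) R ⟩
        between f (not ∘ R) R + ⟦ R r ⟧ * suc j    ≡⟨ cong (λ y → between f (not ∘ R) R + ⟦ y ⟧ * suc j) root ⟩
        between f (not ∘ R) R + (suc j + 0)        ≡⟨ cong (between f (not ∘ R) R +_) (+-identityʳ (suc j)) ⟩
        between f (not ∘ R) R + suc j              ≡⟨ +-suc _ j ⟩
        suc (between f (not ∘ R) R + j)            ∎
        where open ≡-Reasoning

  Decomposition : BoolRel n → ℕ → Set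
  Decomposition f j = Σ[ ps ∈ Vec (List (Fin n)) j ]
    (∀ i → IsPath G r t (lookup ps i)) ×
    (∀ i → All (λ e → f (proj₁ e) (proj₂ e) ≡ true) (edgesOf (lookup ps i))) ×
    (∀ i i′ → i ≢ i′ → EdgeDisjoint (lookup ps i) (lookup ps i′))

  extend : ∀ {f f′ : BoolRel n} {j vs} → (∀ {a b} → f a b ≡ true → g a b ≡ true) →
    SimplePath (FlowEdge f) r t vs →
    (∀ {a b} → f′ a b ≡ true → f a b ≡ true × (a , b) ∉ edgesOf (r ∷ vs)) →
    Decomposition f′ j → Decomposition f (suc j)
  extend {f} {f′} {j} {vs} f⊆g path kept (ps , isPath , inF′ , disjoint) =
    (r ∷ vs) ∷ ps , isPath′ , inF , disjoint′
    where
    isPath′ : ∀ i → IsPath G r t (lookup ((r ∷ vs) ∷ ps) i)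
    isPath′ zero = simple-isPath G (does⇒ (G? _ _) ∘ f⊆g) path
    isPath′ (suc i) = isPath i

    inF : ∀ i → All (λ e → f (proj₁ e) (proj₂ e) ≡ true) (edgesOf (lookup ((r ∷ vs) ∷ ps) i))
    inF zero = simple-edges path
    inF (suc i) = All.map (proj₁ ∘ kept) (inF′ i)

    avoids : ∀ i e → e ∈ edgesOf (lookup ps i) → e ∉ edgesOf (r ∷ vs)
    avoids i e e∈ = proj₂ (kept (All.lookup (inF′ i) e∈))

    disjoint′ : ∀ i i′ → i ≢ i′ → EdgeDisjoint (lookup ((r ∷ vs) ∷ ps) i) (lookup ((r ∷ vs) ∷ ps) i′)
    disjoint′ zero zero i≢i′ = contradiction refl i≢i′
    disjoint′ zero (suc i′) _ e e∈path e∈p = avoids i′ e e∈p e∈path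
    disjoint′ (suc i) zero _ e e∈p e∈path = avoids i e e∈p e∈path
    disjoint′ (suc i) (suc i′) i≢i′ = disjoint i i′ (i≢i′ ∘ cong suc)

  decompose : ∀ j (F : Flow j) → ¬ ¬ Decomposition (edges F) j
  decompose zero F = pure ([] , (λ ()) , (λ ()) , (λ ()))
  decompose (suc j) F = do
    (vs , path) ← flow-path F
    let (F′ , kept) = remove F path
    paths ← decompose j F′
    pure (extend (within F) path kept paths)

  max-flow-or-small-cut : ∀ m → ¬ ¬ (Flow m ⊎ SmallCut m)
  max-flow-or-small-cut zero = pure (inj₁ empty-flow)
  max-flow-or-small-cut (suc m) = do
    inj₁ F ← max-flow-or-small-cut m
      where inj₂ (X , Xr , Xt , small) → pure (inj₂ (X , Xr , Xt , m<n⇒m<1+n small))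
    augment-or-cut F

  -- a flow of value k would decompose into k edge-disjoint paths
  menger : ∀ k → ¬ HasDisjointPaths G k r t → ¬ ¬ SmallCut k
  menger k no-paths = do
    inj₁ F ← max-flow-or-small-cut k
      where inj₂ cut → pure cut
    (ps , isPath , _ , disjoint) ← decompose k F
    contradiction (ps , isPath , disjoint) no-paths

enters : ∀ {n} → BoolRel n → (Fin n → Bool) → Fin n → Fin n → Bool
enters g X a b = g a b ∧ not (X a) ∧ X b

submodular-at : ∀ e xa xb ya yb →
  ⟦ e ∧ not (xa ∧ ya) ∧ (xb ∧ yb) ⟧ + ⟦ e ∧ not (xa ∨ ya) ∧ (xb ∨ yb) ⟧ ≤
  ⟦ e ∧ not xa ∧ xb ⟧ + ⟦ e ∧ not ya ∧ yb ⟧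
submodular-at false _ _ _ _ = z≤n
submodular-at true true  true  true  true  = z≤n
submodular-at true true  true  true  false = z≤n
submodular-at true true  true  false true  = s≤s z≤n
submodular-at true true  true  false false = z≤n
submodular-at true true  false true  true  = z≤n
submodular-at true true  false true  false = z≤n
submodular-at true true  false false true  = z≤n
submodular-at true true  false false false = z≤n
submodular-at true false true  true  true  = s≤s z≤n
submodular-at true false true  true  false = z≤n
submodular-at true false true  false true  = s≤s (s≤s z≤n)
submodular-at true false true  false false = s≤s z≤n
submodular-at true false false true  true  = z≤n
submodular-at true false false true  false = z≤n
submodular-at true false false false true  = s≤s z≤n
submodular-at true false false false false = z≤n

ρ-submodular : ∀ {n} (g : BoolRel n) (X Y : Fin n → Bool) →
  ρ g (λ v → X v ∧ Y v) + ρ g (λ v → X v ∨ Y v) ≤ ρ g X + ρ g Y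
ρ-submodular {n} g X Y = subst₂ _≤_
  (∑∑-distrib-+ (count (λ v → X v ∧ Y v)) (count (λ v → X v ∨ Y v)))
  (∑∑-distrib-+ (count X) (count Y))
  (∑∑-mono (λ a b → submodular-at (g a b) (X a) (X b) (Y a) (Y b)))
  where
  count : (Fin n → Bool) → Fin n → Fin n → ℕ
  count Z a b = ⟦ enters g Z a b ⟧

true⇒1≤ : ∀ {b} → b ≡ true → 1 ≤ ⟦ b ⟧
true⇒1≤ refl = s≤s z≤n

enters-true : ∀ {n} {g : BoolRel n} {X a b} → g a b ≡ true → X a ≡ false → X b ≡ true → enters g X a b ≡ true
enters-true gab Xa Xb rewrite gab | Xa | Xb = refl

walk-enters : ∀ {n} (g : BoolRel n) (Y : Fin n → Bool) x xs →
  All (λ e → g (proj₁ e) (proj₂ e) ≡ true) (edgesOf (x ∷ xs)) → Y x ≡ false →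
  ∀ {z} → z ∈ x ∷ xs → Y z ≡ true →
  ∃ λ e → e ∈ edgesOf (x ∷ xs) × enters g Y (proj₁ e) (proj₂ e) ≡ true
walk-enters g Y x [] _ Yx (here refl) Yz = contradiction (trans (sym Yx) Yz) λ ()
walk-enters g Y x (y ∷ xs) (gxy ∷ gs) Yx z∈ Yz with Y y in Yy | z∈
... | true | _ = (x , y) , here refl , enters-true {g = g} {Y} gxy Yx Yy
... | false | here refl = contradiction (trans (sym Yx) Yz) λ ()
... | false | there z∈′ with walk-enters g Y y xs gs Yy z∈′ Yz
...   | e , e∈ , entering = e , there e∈ , entering

ρ-delete-edge : ∀ {n} (h g : BoolRel n) x w → (∀ a b → h a b ≡ true → g a b ≡ false → a ≡ x × b ≡ w) →
  ∀ X → ρ h X ≤ ρ g X + ⟦ not (X x) ∧ X w ⟧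
ρ-delete-edge h g x w deleted X = begin
  ρ h X                                                          ≤⟨ ∑∑-mono at ⟩
  ∑∑ (λ a b → ⟦ enters g X a b ⟧ + δ a x * δ b w * ⟦ not (X a) ∧ X b ⟧)
                                                                 ≡⟨ ∑∑-distrib-+ (λ a b → ⟦ enters g X a b ⟧) _ ⟩
  ρ g X + ∑∑ (λ a b → δ a x * δ b w * ⟦ not (X a) ∧ X b ⟧)       ≡⟨ cong (ρ g X +_) (∑∑-sift x w _) ⟩
  ρ g X + ⟦ not (X x) ∧ X w ⟧                                    ∎
  where
  open ≤-Reasoning
  at : ∀ a b → ⟦ enters h X a b ⟧ ≤ ⟦ enters g X a b ⟧ + δ a x * δ b w * ⟦ not (X a) ∧ X b ⟧
  at a b with h a b in hab | g a b in gab
  ... | false | _ = z≤n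
  ... | true | true = m≤m+n _ _
  ... | true | false with deleted a b hab gab
  ...   | refl , refl rewrite δ-refl a | δ-refl b = ≤-reflexive (sym (+-identityʳ _))

violated-terminal : ∀ {n} {G : Digraph n} {r T k} → ¬ Feasible G r T k →
  ¬ ¬ (∃ λ t → T t × ¬ HasDisjointPaths G k r t)
violated-terminal {G = G} {r} {T} {k} infeasible no-violation =
  ¬¬-decide-all (λ t → HasDisjointPaths G k r t) λ decided →
    infeasible λ t Tt → decidable-stable (decided t) (λ no-paths → no-violation (t , Tt , no-paths))

-- For an edge
-- x w, minimality and Menger give a tight set: it contains w and a terminal,
-- avoids r and x, and has at most k entering edges.  Uncrossing the tight
-- sets of all edges into w yields one set with at most k entering edges that
-- every edge into w enters.

module MinimalSolutionInDegree {n} (H : Digraph n) (H? : ∀ a b → Dec (H a b))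
  (r : Fin n) (T : Fin n → Set) (k : ℕ) (minimal : MinimalSolution H r T k) where

  h : BoolRel n
  h a b = does (H? a b)

  path-enters : ∀ Y {t vs} → IsPath H r t vs → Y r ≡ false → Y t ≡ true →
    ∃ λ e → e ∈ edgesOf vs × enters h Y (proj₁ e) (proj₂ e) ≡ true
  path-enters Y p Yr Yt with IsPath.starts p | IsPath.ends p
  ... | rest , refl | init , p≡init∷ʳt =
    walk-enters h Y r rest (All.map (dec-true (H? _ _)) (IsPath.inGraph p)) Yr
      (subst (_ ∈_) (sym p≡init∷ʳt) (∈-++⁺ʳ init (here refl))) Yt

  cut-lower-bound : ∀ Y {t} → T t → Y r ≡ false → Y t ≡ true → k ≤ ρ h Y
  cut-lower-bound Y {t} Tt Yr Yt with proj₁ minimal t Tt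
  ... | ps , isPath , disjoint = begin
    k                           ≡⟨ List.length-tabulate crossing ⟨
    length (tabulate crossing)  ≤⟨ count-distinct-pairs (λ a b → ⟦ enters h Y a b ⟧) (tabulate crossing)
                                     (Unique.tabulate⁺ crossing-injective)
                                     (All.tabulate⁺ (true⇒1≤ ∘ proj₂ ∘ proj₂ ∘ crossing-of)) ⟩
    ρ h Y                       ∎
    where
    open ≤-Reasoning
    crossing-of : ∀ i → ∃ λ e → e ∈ edgesOf (lookup ps i) × enters h Y (proj₁ e) (proj₂ e) ≡ true
    crossing-of i = path-enters Y (isPath i) Yr Yt
    crossing : Fin k → Fin n × Fin n
    crossing = proj₁ ∘ crossing-of
    crossing-injective : ∀ {i i′} → crossing i ≡ crossing i′ → i ≡ i′
    crossing-injective {i} {i′} same with i ≟ i′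
    ... | yes i≡i′ = i≡i′
    ... | no i≢i′ = contradiction (subst (_∈ edgesOf (lookup ps i′)) (sym same) (proj₁ (proj₂ (crossing-of i′))))
                                  (disjoint i i′ i≢i′ (crossing i) (proj₁ (proj₂ (crossing-of i))))

  record Tight (x w : Fin n) (X : Fin n → Bool) : Set where
    field
      root∉ : X r ≡ false
      tail∉ : X x ≡ false
      head∈ : X w ≡ true
      terminal : ∃ λ t → T t × X t ≡ true
      small : ρ h X ≤ k
  open Tight

  tight-set : ∀ {x w} → H x w → ¬ ¬ (Σ[ X ∈ (Fin n → Bool) ] Tight x w X)
  tight-set {x} {w} Hxw = do
    (t , Tt , no-paths) ← violated-terminal (proj₂ minimal x w Hxw)
    (X , Xr , Xt , smaller) ← Menger.menger (Remove H x w) Remove? r t k no-paths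
    pure (X , tight X Xr Xt Tt smaller)
    where
    Remove? : ∀ a b → Dec (Remove H x w a b)
    Remove? a b = H? a b ×-dec ¬? ((a ≟ x) ×-dec (b ≟ w))
    g : BoolRel n
    g a b = does (Remove? a b)

    deleted : ∀ a b → h a b ≡ true → g a b ≡ false → a ≡ x × b ≡ w
    deleted a b hab gab = decidable-stable ((a ≟ x) ×-dec (b ≟ w)) λ not-xw →
      contradiction (trans (sym (dec-true (Remove? a b) (does⇒ (H? a b) hab , not-xw))) gab) λ ()

    tight : ∀ X → X r ≡ false → ∀ {t} → X t ≡ true → T t → ρ g X < k → Tight x w X
    tight X Xr Xt Tt smaller with not (X x) ∧ X w in enters-X | ρ-delete-edge h g x w deleted X
    ... | false | ρ≤ = contradiction (≤-trans (cut-lower-bound X Tt Xr Xt) (subst (ρ h X ≤_) (+-identityʳ _) ρ≤))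
                                     (<⇒≱ smaller)
    ... | true | ρ≤ = record
      { root∉ = Xr ; tail∉ = not-true (proj₁ (∧-true enters-X)) ; head∈ = proj₂ (∧-true enters-X)
      ; terminal = _ , Tt , Xt ; small = ≤-trans ρ≤ (subst (_≤ k) (+-comm 1 _) smaller) }

  uncross : ∀ X Y {t} → T t → X r ≡ false → X t ≡ true → ρ h X ≤ k → Y r ≡ false → ρ h Y ≤ k →
    ρ h (λ v → X v ∧ Y v) ≤ k
  uncross X Y {t} Tt Xr Xt ρX≤k Yr ρY≤k = +-cancelʳ-≤ k _ _ (begin
    ρ h (λ v → X v ∧ Y v) + k                      ≤⟨ +-monoʳ-≤ _ (cut-lower-bound (λ v → X v ∨ Y v) Tt
                                                                    (cong₂ _∨_ Xr Yr) (cong (_∨ Y t) Xt)) ⟩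
    ρ h (λ v → X v ∧ Y v) + ρ h (λ v → X v ∨ Y v)  ≤⟨ ρ-submodular h X Y ⟩
    ρ h X + ρ h Y                                  ≤⟨ +-mono-≤ ρX≤k ρY≤k ⟩
    k + k                                          ∎)
    where open ≤-Reasoning

  meet : (Fin n → Fin n → Bool) → Fin n → List (Fin n) → Fin n → Bool
  meet X a [] = X a
  meet X a (b ∷ bs) v = X a v ∧ meet X b bs v

  module _ {w : Fin n} (X : Fin n → Fin n → Bool) (tight : ∀ {a} → H a w → Tight a w (X a)) where

    meet-small : ∀ a as → All (λ b → H b w) (a ∷ as) → meet X a as r ≡ false × ρ h (meet X a as) ≤ k
    meet-small a [] (Haw ∷ []) = root∉ (tight Haw) , small (tight Haw)
    meet-small a (b ∷ bs) (Haw ∷ Hs) with meet-small b bs Hs | terminal (tight Haw)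
    ... | Zr , ρZ≤k | t , Tt , Xt =
      cong (_∧ meet X b bs r) (root∉ (tight Haw)) ,
      uncross (X a) (meet X b bs) Tt (root∉ (tight Haw)) Xt (small (tight Haw)) Zr ρZ≤k

    meet-excludes : ∀ {b} a as → b ∈ a ∷ as → H b w → meet X a as b ≡ false
    meet-excludes a [] (here refl) Hbw = tail∉ (tight Hbw)
    meet-excludes a (c ∷ cs) (here refl) Hbw = cong (_∧ meet X c cs a) (tail∉ (tight Hbw))
    meet-excludes {b} a (c ∷ cs) (there b∈) Hbw =
      trans (cong (X a b ∧_) (meet-excludes c cs b∈ Hbw)) (∧-zeroʳ (X a b))

    meet-includes : ∀ a as → All (λ b → H b w) (a ∷ as) → meet X a as w ≡ true
    meet-includes a [] (Haw ∷ []) = head∈ (tight Haw)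
    meet-includes a (b ∷ bs) (Haw ∷ Hs) = cong₂ _∧_ (head∈ (tight Haw)) (meet-includes b bs Hs)

    -- every edge into w enters the intersection of the tight sets of these edges
    in-degree≤k : in-degree h w ≤ k
    in-degree≤k = via (filter (λ a → H? a w) (allFin n))
                      (proj₂ ∘ ∈-filter⁻ (λ a → H? a w) {xs = allFin n})
                      (∈-filter⁺ (λ a → H? a w) (∈-allFin _))
      where
      via : ∀ L → (∀ {a} → a ∈ L → H a w) → (∀ {a} → H a w → a ∈ L) → in-degree h w ≤ k
      via [] _ complete = ≤-trans (≤-reflexive (sum-zero none)) z≤n
        where
        none : ∀ a → ⟦ h a w ⟧ ≡ 0
        none a with H? a w
        ... | yes Haw with complete Haw
        ...   | ()
        none a | no _ = refl
      via (a ∷ as) sound complete = begin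
        in-degree h w                   ≤⟨ sum-mono entering ⟩
        ρ h (meet X a as)               ≤⟨ proj₂ (meet-small a as (All.tabulate sound)) ⟩
        k                               ∎
        where
        open ≤-Reasoning
        entering : ∀ b → ⟦ h b w ⟧ ≤ ∑[ c < n ] ⟦ enters h (meet X a as) b c ⟧
        entering b with H? b w
        ... | no _ = z≤n
        ... | yes Hbw = ≤-trans
          (true⇒1≤ (enters-true {g = h} {meet X a as} (dec-true (H? b w) Hbw)
                     (meet-excludes a as (complete Hbw) Hbw) (meet-includes a as (All.tabulate sound))))
          (term≤sum (λ c → ⟦ enters h (meet X a as) b c ⟧) w)

  in-degree-bound : ∀ w → ¬ ¬ (in-degree h w ≤ k)
  in-degree-bound w = do
    chosen ← ¬¬-finite-choice choose
    pure (in-degree≤k (proj₁ ∘ chosen) (λ {a} → proj₂ (chosen a)))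
    where
    choose : ∀ a → ¬ ¬ (Σ[ X ∈ (Fin n → Bool) ] (H a w → Tight a w X))
    choose a with H? a w
    ... | yes Haw = do
      (X , tightX) ← tight-set Haw
      pure (X , λ _ → tightX)
    ... | no ¬Haw = pure ((λ _ → true) , λ Haw → contradiction Haw ¬Haw)

dropLast : ∀ {A : Set} → List A → List A
dropLast [] = []
dropLast (x ∷ []) = []
dropLast (x ∷ y ∷ xs) = x ∷ dropLast (y ∷ xs)

-- the last element of d ∷ xs
lastOr : ∀ {A : Set} → A → List A → A
lastOr d [] = d
lastOr d (x ∷ xs) = lastOr x xs

dropLast-∷ʳ : ∀ {A : Set} (xs : List A) a → dropLast (xs ∷ʳ a) ≡ xs
dropLast-∷ʳ [] a = refl
dropLast-∷ʳ (x ∷ []) a = refl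
dropLast-∷ʳ (x ∷ y ∷ xs) a = cong (x ∷_) (dropLast-∷ʳ (y ∷ xs) a)

lastOr-∷ʳ : ∀ {A : Set} (d : A) xs a → lastOr d (xs ∷ʳ a) ≡ a
lastOr-∷ʳ d [] a = refl
lastOr-∷ʳ d (x ∷ xs) a = lastOr-∷ʳ x xs a

∷ʳ-view : ∀ {A : Set} (x : A) xs → x ∷ xs ≡ dropLast (x ∷ xs) ∷ʳ lastOr x xs
∷ʳ-view x [] = refl
∷ʳ-view x (y ∷ xs) = cong (x ∷_) (∷ʳ-view y xs)

two-last : ∀ {A : Set} {a u v : A} init → a ∷ [] ≢ init ++ u ∷ v ∷ []
two-last [] ()
two-last (_ ∷ []) ()
two-last (_ ∷ _ ∷ _) ()

unique-++⁻ˡ : ∀ {A : Set} (xs : List A) {ys} → Unique (xs ++ ys) → Unique xs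
unique-++⁻ˡ [] _ = []
unique-++⁻ˡ (x ∷ xs) (x∉ ∷ xs!) = All.++⁻ˡ xs x∉ ∷ unique-++⁻ˡ xs xs!

map-unique-on : ∀ {A B : Set} {P : A → Set} (f : A → B) → (∀ {x y} → P x → P y → f x ≡ f y → x ≡ y) →
  ∀ xs → Unique xs → All P xs → Unique (map f xs)
map-unique-on f injective [] _ _ = []
map-unique-on {P = P} f injective (x ∷ xs) (x∉ ∷ xs!) (Px ∷ Pxs) =
  apart xs x∉ Pxs ∷ map-unique-on f injective xs xs! Pxs
  where
  apart : ∀ ys → All (x ≢_) ys → All P ys → All (f x ≢_) (map f ys)
  apart [] _ _ = []
  apart (y ∷ ys) (x≢y ∷ x∉) (Py ∷ Pys) = (x≢y ∘ injective Px Py) ∷ apart ys x∉ Pys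

edgesOf-∷ʳ : ∀ {n} (x : Fin n) xs a → edgesOf ((x ∷ xs) ∷ʳ a) ≡ edgesOf (x ∷ xs) ∷ʳ (lastOr x xs , a)
edgesOf-∷ʳ x [] a = refl
edgesOf-∷ʳ x (y ∷ xs) a = cong ((x , y) ∷_) (edgesOf-∷ʳ y xs a)

pathLength-∷ʳ : ∀ {n} (x : Fin n) xs a → pathLength ((x ∷ xs) ∷ʳ a) ≡ suc (pathLength (x ∷ xs))
pathLength-∷ʳ x xs a = begin
  length (edgesOf ((x ∷ xs) ∷ʳ a))                       ≡⟨ cong length (edgesOf-∷ʳ x xs a) ⟩
  length (edgesOf (x ∷ xs) ∷ʳ (lastOr x xs , a))         ≡⟨ List.length-++ (edgesOf (x ∷ xs)) ⟩
  pathLength (x ∷ xs) + 1                                ≡⟨ +-comm _ 1 ⟩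
  suc (pathLength (x ∷ xs))                              ∎
  where open ≡-Reasoning

1≤^ : ∀ {k} → 1 ≤ k → ∀ j → 1 ≤ k ^ j
1≤^ 1≤k zero = s≤s z≤n
1≤^ 1≤k (suc j) = *-mono-≤ 1≤k (1≤^ 1≤k j)

-- A path to y ≠ r is
-- a shorter path to its penultimate vertex x followed by the edge x y, so the
-- paths to y split into at most k nonempty classes according to x.

module PathCounting {n} (H : Digraph n) (H? : ∀ a b → Dec (H a b)) (r : Fin n) (k : ℕ) (1≤k : 1 ≤ k)
  (in-degree≤k : ∀ y → in-degree (λ a b → does (H? a b)) y ≤ k) where

  penultimate : List (Fin n) → Fin n
  penultimate q = lastOr r (dropLast q)

  record LastEdge (y : Fin n) (q : List (Fin n)) : Set where
    field
      prefix : IsPath H r (penultimate q) (dropLast q)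
      edge : H (penultimate q) y
      shorter : suc (pathLength (dropLast q)) ≡ pathLength q
      restore : q ≡ dropLast q ∷ʳ y
  open LastEdge

  split-last : ∀ {y} is → IsPath H r y ((r ∷ is) ∷ʳ y) →
    IsPath H r (lastOr r is) (r ∷ is) × H (lastOr r is) y
  split-last {y} is p with All.++⁻ (edgesOf (r ∷ is)) (subst (All _) (edgesOf-∷ʳ r is y) (IsPath.inGraph p))
  ... | prefix-edges , final-edge ∷ [] = record
    { starts = is , refl
    ; ends = dropLast (r ∷ is) , ∷ʳ-view r is
    ; inGraph = prefix-edges
    ; distinct = unique-++⁻ˡ (r ∷ is) (IsPath.distinct p) } , final-edge

  last-edge : ∀ {y q} → y ≢ r → IsPath H r y q → LastEdge y q
  last-edge {y} y≢r p with IsPath.starts p | IsPath.ends p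
  ... | rest , refl | [] , r∷rest≡y = contradiction (sym (proj₁ (∷-injective r∷rest≡y))) y≢r
  ... | rest , refl | i₀ ∷ is , r∷rest≡i₀∷is∷ʳy with ∷-injective r∷rest≡i₀∷is∷ʳy
  ...   | refl , refl = record
    { prefix = subst (λ d → IsPath H r (lastOr r d) d) (sym drop) (proj₁ (split-last is p))
    ; edge = subst (λ d → H (lastOr r d) y) (sym drop) (proj₂ (split-last is p))
    ; shorter = subst (λ d → suc (pathLength d) ≡ pathLength ((r ∷ is) ∷ʳ y)) (sym drop)
                      (sym (pathLength-∷ʳ r is y))
    ; restore = cong (_∷ʳ y) (sym drop) }
    where
    drop : dropLast ((r ∷ is) ∷ʳ y) ≡ r ∷ is
    drop = dropLast-∷ʳ (r ∷ is) y

  only-trivial : ∀ {q} → IsPath H r r q → r ∷ [] ≡ q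
  only-trivial p with IsPath.starts p | IsPath.ends p | IsPath.distinct p
  ... | _ | [] , refl | _ = refl
  ... | rest , refl | i₀ ∷ is , r∷rest≡i₀∷is∷ʳr | r∉rest ∷ _ with ∷-injective r∷rest≡i₀∷is∷ʳr
  ...   | refl , refl = contradiction refl (All.lookup r∉rest (∈-++⁺ʳ is (here refl)))

  ShortPath : ℕ → Fin n → List (Fin n) → Set
  ShortPath j y q = IsPath H r y q × pathLength q ≤ suc j

  single-edge : ∀ {y q} → y ≢ r → ShortPath 0 y q → r ∷ y ∷ [] ≡ q
  single-edge {y} y≢r (p , length≤1) with last-edge y≢r p
  ... | split with IsPath.starts (prefix split)
  ...   | [] , prefix≡r = sym (trans (restore split) (cong (_∷ʳ y) prefix≡r))
  ...   | _ ∷ _ , prefix≡r∷z∷_ with subst (λ d → suc (pathLength d) ≤ 1) prefix≡r∷z∷_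
                                       (subst (_≤ 1) (sym (shorter split)) length≤1)
  ...     | s≤s ()

  drop-last-vertex : ∀ {y x j} qs → y ≢ r → Unique qs →
    All (λ q → ShortPath (suc j) y q × x ≡ penultimate q) qs →
    Unique (map dropLast qs) × All (ShortPath j x) (map dropLast qs)
  drop-last-vertex {y} {x} {j} qs y≢r qs! into-y =
    map-unique-on dropLast same-prefix qs qs! into-y ,
    All.map⁺ (All.map shortened into-y)
    where
    same-prefix : ∀ {q q′} → ShortPath (suc j) y q × x ≡ penultimate q → ShortPath (suc j) y q′ × x ≡ penultimate q′ →
      dropLast q ≡ dropLast q′ → q ≡ q′
    same-prefix ((p , _) , _) ((p′ , _) , _) same =
      trans (restore (last-edge y≢r p)) (trans (cong (_∷ʳ y) same) (sym (restore (last-edge y≢r p′))))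
    shortened : ∀ {q} → ShortPath (suc j) y q × x ≡ penultimate q → ShortPath j x (dropLast q)
    shortened ((p , length≤) , refl) =
      prefix (last-edge y≢r p) , ≤-pred (subst (_≤ suc (suc j)) (sym (shorter (last-edge y≢r p))) length≤)

  short-paths-bound : ∀ j y qs → Unique qs → All (ShortPath j y) qs → length qs ≤ k ^ j
  short-paths-bound j y qs qs! short with y ≟ r
  ... | yes refl = ≤-trans (unique-constant qs qs! (All.map (only-trivial ∘ proj₁) short)) (1≤^ 1≤k j)
  short-paths-bound zero y qs qs! short | no y≢r = unique-constant qs qs! (All.map (single-edge y≢r) short)
  short-paths-bound (suc j) y qs qs! short | no y≢r = begin
    length qs                                 ≤⟨ count-by-fibres penultimate (λ x → ⟦ h x y ⟧ * k ^ j)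
                                                   fibre-bound qs qs! short ⟩
    ∑[ x < n ] (⟦ h x y ⟧ * k ^ j)            ≡⟨ sum-cong-≗ (λ x → *-comm ⟦ h x y ⟧ (k ^ j)) ⟩
    ∑[ x < n ] (k ^ j * ⟦ h x y ⟧)            ≡⟨ *-distribˡ-sum (k ^ j) (λ x → ⟦ h x y ⟧) ⟨
    k ^ j * in-degree h y                     ≤⟨ *-monoʳ-≤ (k ^ j) (in-degree≤k y) ⟩
    k ^ j * k                                 ≡⟨ *-comm (k ^ j) k ⟩
    k ^ suc j                                 ∎
    where
    open ≤-Reasoning
    h : BoolRel n
    h a b = does (H? a b)

    -- the paths into y with penultimate vertex x: none unless x y is an edge,
    -- and otherwise as many as their prefixes into x
    fibre-bound : ∀ x ps → Unique ps → All (λ q → ShortPath (suc j) y q × x ≡ penultimate q) ps →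
      length ps ≤ ⟦ h x y ⟧ * k ^ j
    fibre-bound x [] _ _ = z≤n
    fibre-bound x ps@(q ∷ _) ps! into-y@(((p , _) , refl) ∷ _) = begin
      length ps                     ≡⟨ List.length-map dropLast ps ⟨
      length (map dropLast ps)      ≤⟨ short-paths-bound j x (map dropLast ps) (proj₁ prefixes) (proj₂ prefixes) ⟩
      k ^ j                         ≡⟨ +-identityʳ (k ^ j) ⟨
      ⟦ true ⟧ * k ^ j              ≡⟨ cong (λ b → ⟦ b ⟧ * k ^ j) (dec-true (H? x y) (edge (last-edge y≢r p))) ⟨
      ⟦ h x y ⟧ * k ^ j             ∎
      where
      prefixes : Unique (map dropLast ps) × All (ShortPath j x) (map dropLast ps)
      prefixes = drop-last-vertex ps y≢r ps! into-y

  penultimate-Q : ∀ init {u v} → penultimate (init ++ u ∷ v ∷ []) ≡ u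
  penultimate-Q init {u} {v} = begin
    lastOr r (dropLast (init ++ u ∷ v ∷ []))   ≡⟨ cong (lastOr r ∘ dropLast) (List.++-assoc init (u ∷ []) (v ∷ [])) ⟨
    lastOr r (dropLast ((init ∷ʳ u) ∷ʳ v))     ≡⟨ cong (lastOr r) (dropLast-∷ʳ (init ∷ʳ u) v) ⟩
    lastOr r (init ∷ʳ u)                       ≡⟨ lastOr-∷ʳ r init u ⟩
    u                                          ∎
    where open ≡-Reasoning

  -- dropping the last vertex maps Q_ℓ(u v) injectively to paths into u of length at most ℓ-1
  Q-bound : ∀ {u v ℓ} → 2 ≤ ℓ → ∀ qs → Unique qs → All (InQ H r ℓ u v) qs → length qs ≤ k ^ (ℓ ∸ 2)
  Q-bound _ [] _ _ = z≤n
  Q-bound {u} {v} {suc (suc ℓ)} (s≤s (s≤s z≤n)) qs@(_ ∷ _) qs! inQ@((q-path , (init , q≡) , _) ∷ _) = begin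
    length qs                  ≡⟨ List.length-map dropLast qs ⟨
    length (map dropLast qs)   ≤⟨ short-paths-bound ℓ u (map dropLast qs) (proj₁ prefixes) (proj₂ prefixes) ⟩
    k ^ ℓ                      ∎
    where
    open ≤-Reasoning
    v≢r : v ≢ r
    v≢r refl = two-last init (trans (only-trivial q-path) q≡)

    as-short-path : ∀ {q} → InQ H r (suc (suc ℓ)) u v q → ShortPath (suc ℓ) v q × u ≡ penultimate q
    as-short-path (p , (front , refl) , length≤) = (p , length≤) , sym (penultimate-Q front)

    prefixes : Unique (map dropLast qs) × All (ShortPath ℓ u) (map dropLast qs)
    prefixes = drop-last-vertex qs v≢r qs! (All.map as-short-path inQ)

-- decide H classically, bound all in-degrees by minimality, then count
lemma6 : ∀ {n} (H : Digraph n) (r : Fin n) (T : Fin n → Set) (k : ℕ) →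
    1 ≤ k → Loopless H → MinimalSolution H r T k →
    ∀ u v → H u v → ∀ (ℓ : ℕ) → 2 ≤ ℓ →
    (qs : List (List (Fin n))) → Unique qs → All (InQ H r ℓ u v) qs →
    length qs ≤ k ^ (ℓ ∸ 2)
lemma6 H r T k 1≤k _ minimal u v _ ℓ 2≤ℓ qs qs! inQ =
  decidable-stable (length qs ≤? k ^ (ℓ ∸ 2)) do
    H? ← ¬¬-finite-choice (λ a → ¬¬-decide-all (H a))
    in-degree≤k ← ¬¬-finite-choice (MinimalSolutionInDegree.in-degree-bound H H? r T k minimal)
    pure (PathCounting.Q-bound H H? r k 1≤k in-degree≤k 2≤ℓ qs qs! inQ)
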